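{- The following identities between logics hold (where $\mathbf{L}\oplus\chi$ denotes the least set of formulas containing the axioms of $\mathbf{L}$ and all instances of the schema $\chi$, closed under the rules of $\mathbf{L}$): (1) $\mathbf{S4.2}^{[\mathsf{tB}^\mathtt{MS}]}\oplus\big([\mathsf{tB}^\mathtt{MS}]^x\phi\to[\mathsf{K}][\mathsf{tB}^\mathtt{MS}]^x\phi\big)=\mathbf{S4.2}^{[\mathsf{tB}^\mathtt{MS}]}\oplus\big([\mathsf{B}]\phi\wedge\phi\to[\mathsf{K}]\phi\big)$; (2) $\mathbf{S4.2}^{[\mathsf{tB}^\mathtt{MS}_\mathtt{FS}]}\oplus\big([\mathsf{tB}^\mathtt{MS}_\mathtt{FS}]^x\phi\to[\mathsf{K}][\mathsf{tB}^\mathtt{MS}_\mathtt{FS}]^x\phi\big)=\mathbf{S4.2}^{[\mathsf{tB}^\mathtt{MS}_\mathtt{FS}]}\oplus\big([\mathsf{B}]\phi\wedge\phi\to[\mathsf{K}]\phi\big)$; (3) $\mathbf{S4.2}_\approx^{[\mathsf{K}^\mathtt{MS}_\mathtt{FS}]}\oplus\big([\mathsf{K}^\mathtt{MS}_\mathtt{FS}]^x\phi\to[\mathsf{K}][\mathsf{K}^\mathtt{MS}_\mathtt{FS}]^x\phi\big)=\mathbf{S4.2}_\approx^{[\mathsf{K}^\mathtt{MS}_\mathtt{FS}]}\oplus\big(\neg(x\approx y)\to([\mathsf{B}]\phi\wedge\phi\to[\mathsf{K}]\phi)\big)$.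
   Context: Fix a set $\mathcal{P}$ of predicate symbols with arities and a countably infinite set $\mathbf{X}$ of variables. For $[\mathsf{K}_\mathtt{wh}]\in\{[\mathsf{tB}^\mathtt{MS}],[\mathsf{tB}^\mathtt{MS}_\mathtt{FS}],[\mathsf{K}^\mathtt{MS}_\mathtt{FS}]\}$, the language $\mathcal{L}([\mathsf{K}_\mathtt{wh}])$ is $\phi ::= P(y_1,\dots,y_n)\mid\neg\phi\mid\phi\wedge\phi\mid[\mathsf{K}]\phi\mid[\mathsf{K}_\mathtt{wh}]^x\phi$, where $[\mathsf{K}_\mathtt{wh}]^x$ binds $x$; $\mathcal{L}_\approx([\mathsf{K}_\mathtt{wh}])$ adds atoms $x\approx y$. Abbreviations: $\langle\mathsf{K}\rangle\phi:=\neg[\mathsf{K}]\neg\phi$, $[\mathsf{B}]\phi:=\langle\mathsf{K}\rangle[\mathsf{K}]\phi$. $FV(\phi)$: free variables; $\phi[y/x]$: replace free $x$ by $y$, with $y$ admissible. Schemas range over all formulas $\phi$ and variables $x,y$ of the relevant language. Proof systems. $\mathbf{S4.2}^{[\mathsf{K}]}$: all instances of propositional tautologies and of $[\mathsf{K}](\phi\to\psi)\to([\mathsf{K}]\phi\to[\mathsf{K}]\psi)$, $[\mathsf{K}]\phi\to\phi$, $[\mathsf{K}]\phi\to[\mathsf{K}][\mathsf{K}]\phi$, $\langle\mathsf{K}\rangle[\mathsf{K}]\phi\to[\mathsf{K}]\langle\mathsf{K}\rangle\phi$, with modus ponens and necessitation for $[\mathsf{K}]$. Axiom schemas: $\mathtt{TBtoK_{wh}}$: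 $([\mathsf{B}]\phi\wedge\phi)[y/x]\to[\mathsf{K}_\mathtt{wh}]^x\phi$; $\mathtt{K_{wh}toFS}$: $[\mathsf{K}_\mathtt{wh}]^x\phi\to([\mathsf{B}]\phi\to\phi)[y/x]$; $\mathtt{BtoBK_{wh}}$: $[\mathsf{B}]\phi[y/x]\to[\mathsf{B}][\mathsf{K}_\mathtt{wh}]^x\phi$. Rules (any $n\ge0$, formulas $\psi_0..\psi_n$ with $x\notin\bigcup_i FV(\psi_i)$; $C[\chi]$ denotes $\psi_0\to[\mathsf{K}](\psi_1\to\cdots[\mathsf{K}](\psi_n\to\chi)\cdots)$): $\mathtt{K_{wh}toTB}$: from $\vdash C[\neg([\mathsf{B}]\phi\wedge\phi)]$ infer $\vdash C[\neg[\mathsf{K}_\mathtt{wh}]^x\phi]$; $\mathtt{K_{wh}toK}$: from $\vdash C[\neg[\mathsf{K}]\phi]$ infer $\vdash C[\neg[\mathsf{K}_\mathtt{wh}]^x\phi]$; $\mathtt{FS\&BtoK_{wh}}$: from $\vdash C[[\mathsf{B}]\phi\to\phi]$ infer $\vdash C[[\mathsf{B}]\phi[y/x]\to[\mathsf{K}_\mathtt{wh}]^x\phi]$; $\mathtt{FS\&KtoK_{wh}}$: from $\vdash C[[\mathsf{B}]\phi\to\phi]$ infer $\vdash C[[\mathsf{K}]\phi[y/x]\to[\mathsf{K}_\mathtt{wh}]^x\phi]$. Logics: $\mathbf{S4.2}^{[\mathsf{tB}^\mathtt{MS}]}=\mathbf{S4.2}^{[\mathsf{K}]}+\mathtt{TBtoK_{wh}},\mathtt{K_{wh}toTB}$;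 $\mathbf{S4.2}^{[\mathsf{tB}^\mathtt{MS}_\mathtt{FS}]}=\mathbf{S4.2}^{[\mathsf{K}]}+\mathtt{K_{wh}toFS},\mathtt{BtoBK_{wh}},\mathtt{K_{wh}toTB},\mathtt{FS\&BtoK_{wh}}$; $\mathbf{S4.2}^{[\mathsf{K}^\mathtt{MS}_\mathtt{FS}]}=\mathbf{S4.2}^{[\mathsf{K}]}+\mathtt{K_{wh}toFS},\mathtt{BtoBK_{wh}},\mathtt{K_{wh}toK},\mathtt{FS\&KtoK_{wh}}$ (each with $[\mathsf{K}_\mathtt{wh}]$ instantiated to the respective operator). $\mathbf{S4.2}_\approx^{[\mathsf{K}^\mathtt{MS}_\mathtt{FS}]}$ is $\mathbf{S4.2}^{[\mathsf{K}^\mathtt{MS}_\mathtt{FS}]}$ over $\mathcal{L}_\approx([\mathsf{K}^\mathtt{MS}_\mathtt{FS}])$ plus the axioms $x\approx x$, $x\approx y\to(\phi[x/z]\to\phi[y/z])$, $\neg(x\approx y)\to[\mathsf{K}]\neg(x\approx y)$. -}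

module Defs where

open import Data.Nat using (ℕ; _≡ᵇ_)
open import Data.Bool using (Bool; true; false; T; not; _∧_; if_then_else_)
open import Data.Unit using (⊤; tt)
open import Data.Vec using (Vec)
import Data.Vec as Vec
open import Data.Vec.Relation.Unary.Any using (Any)
open import Data.List using (List; []; _∷_)
open import Data.List.Relation.Unary.All using (All)
open import Data.Product using (_×_)
open import Data.Sum using (_⊎_)
open import Relation.Binary.PropositionalEquality using (_≡_; _≢_)
open import Relation.Nullary using (¬_)

Var : Set
Var = ℕ

module Syntax (Pred : Set) (ar : Pred → ℕ) where

  -- The index E says whether equality atoms x ≈ y are allowed
  -- (E = false : the language L([K_wh]);  E = true : L_≈([K_wh])).
  -- The three operators [tB^MS], [tB^MS_FS], [K^MS_FS] are syntactically the
  -- same binder Wh x φ; which one is meant is fixed by the proof system.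
  data Fm (E : Bool) : Set where
    atom : (P : Pred) → Vec Var (ar P) → Fm E
    eqv  : T E → Var → Var → Fm E
    ~_   : Fm E → Fm E
    _&_  : Fm E → Fm E → Fm E
    K    : Fm E → Fm E
    Wh   : Var → Fm E → Fm E

  infixr 6 _&_
  infixr 5 _⇒_

  _⇒_ : ∀ {E} → Fm E → Fm E → Fm E
  φ ⇒ ψ = ~ (φ & ~ ψ)

  dK : ∀ {E} → Fm E → Fm E
  dK φ = ~ K (~ φ)

  B : ∀ {E} → Fm E → Fm E
  B φ = dK (K φ)

  data _∈FV_ {E} (x : Var) : Fm E → Set where
    fv-atom : ∀ {P ys} → Any (x ≡_) ys → x ∈FV atom P ys
    fv-eqˡ  : ∀ {e y} → x ∈FV eqv e x y
    fv-eqʳ  : ∀ {e y} → x ∈FV eqv e y x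
    fv-neg  : ∀ {φ} → x ∈FV φ → x ∈FV (~ φ)
    fv-andˡ : ∀ {φ ψ} → x ∈FV φ → x ∈FV (φ & ψ)
    fv-andʳ : ∀ {φ ψ} → x ∈FV ψ → x ∈FV (φ & ψ)
    fv-K    : ∀ {φ} → x ∈FV φ → x ∈FV K φ
    fv-Wh   : ∀ {z φ} → z ≢ x → x ∈FV φ → x ∈FV Wh z φ

  -- Substitution  sub y x φ  =  φ[y/x]  (replace free occurrences of x by y)
  rn : Var → Var → Var → Var
  rn y x z = if z ≡ᵇ x then y else z

  sub : ∀ {E} → Var → Var → Fm E → Fm E
  sub y x (atom P ys) = atom P (Vec.map (rn y x) ys)
  sub y x (eqv e a b) = eqv e (rn y x a) (rn y x b)
  sub y x (~ φ)       = ~ sub y x φ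
  sub y x (φ & ψ)     = sub y x φ & sub y x ψ
  sub y x (K φ)       = K (sub y x φ)
  sub y x (Wh z φ)    = if z ≡ᵇ x then Wh z φ else Wh z (sub y x φ)

  Adm : ∀ {E} → Var → Var → Fm E → Set
  Adm y x (atom P ys) = ⊤
  Adm y x (eqv e a b) = ⊤
  Adm y x (~ φ)       = Adm y x φ
  Adm y x (φ & ψ)     = Adm y x φ × Adm y x ψ
  Adm y x (K φ)       = Adm y x φ
  Adm y x (Wh z φ)    = (¬ (x ∈FV Wh z φ)) ⊎ (z ≢ y × Adm y x φ)

  -- Propositional tautologies: formulas true under every Boolean valuation
  -- of their maximal non-Boolean subformulas (atoms, ≈, [K]-, Wh-formulas).
  eval : ∀ {E} → (Fm E → Bool) → Fm E → Bool
  eval v (~ φ)   = not (eval v φ)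
  eval v (φ & ψ) = eval v φ ∧ eval v ψ
  eval v φ@(atom _ _)  = v φ
  eval v φ@(eqv _ _ _) = v φ
  eval v φ@(K _)       = v φ
  eval v φ@(Wh _ _)    = v φ

  Taut : ∀ {E} → Fm E → Set
  Taut φ = ∀ v → eval v φ ≡ true

  -- A logic: a set of axioms and a set of (one-premise) extra rules;
  -- modus ponens and necessitation for [K] are always present.
  record Logic (E : Bool) : Set₁ where
    field
      Ax : Fm E → Set
      Rl : Fm E → Fm E → Set      -- Rl premise conclusion
  open Logic public

  data _⊢_ {E} (L : Logic E) : Fm E → Set where
    ax   : ∀ {φ} → Ax L φ → L ⊢ φ
    mp   : ∀ {φ ψ} → L ⊢ (φ ⇒ ψ) → L ⊢ φ → L ⊢ ψ
    nec  : ∀ {φ} → L ⊢ φ → L ⊢ K φ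
    rule : ∀ {φ ψ} → Rl L φ ψ → L ⊢ φ → L ⊢ ψ

  _⊕_ : ∀ {E} → Logic E → (Fm E → Set) → Logic E
  Ax (L ⊕ χ) φ   = Ax L φ ⊎ χ φ
  Rl (L ⊕ χ) φ ψ = Rl L φ ψ

  _≐_ : ∀ {E} → Logic E → Logic E → Set
  L ≐ L' = ∀ φ → (L ⊢ φ → L' ⊢ φ) × (L' ⊢ φ → L ⊢ φ)

  data S42Ax {E} : Fm E → Set where
    taut : ∀ {φ} → Taut φ → S42Ax φ
    axK  : ∀ φ ψ → S42Ax (K (φ ⇒ ψ) ⇒ (K φ ⇒ K ψ))
    axT  : ∀ φ → S42Ax (K φ ⇒ φ)
    ax4  : ∀ φ → S42Ax (K φ ⇒ K (K φ))
    ax2  : ∀ φ → S42Ax (dK (K φ) ⇒ K (dK φ))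

  data TBtoKwh {E} : Fm E → Set where
    inst : ∀ x y φ → Adm y x φ → TBtoKwh (sub y x (B φ & φ) ⇒ Wh x φ)

  data KwhtoFS {E} : Fm E → Set where
    inst : ∀ x y φ → Adm y x φ → KwhtoFS (Wh x φ ⇒ sub y x (B φ ⇒ φ))

  data BtoBKwh {E} : Fm E → Set where
    inst : ∀ x y φ → Adm y x φ → BtoBKwh (sub y x (B φ) ⇒ B (Wh x φ))

  ctx : ∀ {E} → Fm E → List (Fm E) → Fm E → Fm E
  ctx ψ₀ []        χ = ψ₀ ⇒ χ
  ctx ψ₀ (ψ₁ ∷ ψs) χ = ψ₀ ⇒ K (ctx ψ₁ ψs χ)

  NotFree : ∀ {E} → Var → List (Fm E) → Set
  NotFree x ψs = All (λ ψ → ¬ (x ∈FV ψ)) ψs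

  data KwhtoTB {E} : Fm E → Fm E → Set where
    inst : ∀ x φ ψ₀ ψs → NotFree x (ψ₀ ∷ ψs) →
      KwhtoTB (ctx ψ₀ ψs (~ (B φ & φ))) (ctx ψ₀ ψs (~ Wh x φ))

  data KwhtoK {E} : Fm E → Fm E → Set where
    inst : ∀ x φ ψ₀ ψs → NotFree x (ψ₀ ∷ ψs) →
      KwhtoK (ctx ψ₀ ψs (~ K φ)) (ctx ψ₀ ψs (~ Wh x φ))

  data FSBtoKwh {E} : Fm E → Fm E → Set where
    inst : ∀ x y φ ψ₀ ψs → NotFree x (ψ₀ ∷ ψs) → Adm y x φ →
      FSBtoKwh (ctx ψ₀ ψs (B φ ⇒ φ)) (ctx ψ₀ ψs (sub y x (B φ) ⇒ Wh x φ))

  data FSKtoKwh {E} : Fm E → Fm E → Set where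
    inst : ∀ x y φ ψ₀ ψs → NotFree x (ψ₀ ∷ ψs) → Adm y x φ →
      FSKtoKwh (ctx ψ₀ ψs (B φ ⇒ φ)) (ctx ψ₀ ψs (sub y x (K φ) ⇒ Wh x φ))

  data EqAx : Fm true → Set where
    eq-refl : ∀ x → EqAx (eqv tt x x)
    eq-leib : ∀ x y z φ → Adm x z φ → Adm y z φ →
      EqAx (eqv tt x y ⇒ (sub x z φ ⇒ sub y z φ))
    eq-neq  : ∀ x y → EqAx (~ eqv tt x y ⇒ K (~ eqv tt x y))

  S42-tBMS : Logic false
  Ax S42-tBMS φ   = S42Ax φ ⊎ TBtoKwh φ
  Rl S42-tBMS φ ψ = KwhtoTB φ ψ

  S42-tBMS-FS : Logic false
  Ax S42-tBMS-FS φ   = S42Ax φ ⊎ KwhtoFS φ ⊎ BtoBKwh φ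
  Rl S42-tBMS-FS φ ψ = KwhtoTB φ ψ ⊎ FSBtoKwh φ ψ

  S42≈-KMS-FS : Logic true
  Ax S42≈-KMS-FS φ   = S42Ax φ ⊎ KwhtoFS φ ⊎ BtoBKwh φ ⊎ EqAx φ
  Rl S42≈-KMS-FS φ ψ = KwhtoK φ ψ ⊎ FSKtoKwh φ ψ

  data KwhPI {E} : Fm E → Set where
    inst : ∀ x φ → KwhPI (Wh x φ ⇒ K (Wh x φ))

  data TBtoK {E} : Fm E → Set where
    inst : ∀ φ → TBtoK ((B φ & φ) ⇒ K φ)

  data NeqTBtoK : Fm true → Set where
    inst : ∀ x y φ → NeqTBtoK (~ eqv tt x y ⇒ ((B φ & φ) ⇒ K φ))

-- When x is not free in φ,
-- the rules give [K_wh]^x φ → φ and the axioms give [B]φ ∧ φ → [K_wh]^x φ, so positive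
-- introspection of [K_wh]^x φ yields [B]φ ∧ φ → [K]φ.  Conversely, the rules K_wh-to-TB and
-- K_wh-to-K reduce [K_wh]^x φ → [K][K_wh]^x φ to deriving [K][K_wh]^x φ from [K_wh]^x φ together
-- with [B]φ ∧ φ, resp. [K]φ; since [B]φ is introspective, this follows from [B]φ ∧ φ → [K]φ,
-- which makes the fact-sensitivity condition [B]φ → φ known.  In the logic with equality that
-- schema holds only under ¬(z ≈ x); the case z ≈ x is covered by renaming the bound variable x
-- of [K_wh]^x φ to a fresh z.

module Submission where

open import Defs
open import Data.Nat using (ℕ; zero; suc; _≡ᵇ_; _⊔_; _<_; _≟_; _≤?_)
open import Data.Nat.Properties using (>⇒≢; n<1+n; m⊔n<o⇒m<o; m⊔n<o⇒n<o)
open import Data.Bool using (Bool; true; false; T; not; _∧_)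
open import Data.Bool.Properties using (T-∧; T-≡)
open import Data.Unit using (tt)
open import Data.Empty using (⊥-elim)
open import Data.Fin using (Fin; #_)
open import Data.Vec using (Vec; []; _∷_; lookup)
import Data.Vec as Vec
open import Data.Vec.Properties using (lookup-map; map-cong; map-id; map-∘)
open import Data.Vec.Relation.Unary.All as VecAll using ([]; _∷_)
open import Data.Vec.Relation.Unary.Any using (satisfied)
import Data.Vec.Relation.Unary.Any.Properties as VecAny
open import Data.List using ([]; _∷_)
open import Data.List.Relation.Unary.All using ([]; _∷_)
open import Data.Product using (_×_; _,_; proj₁; proj₂)
open import Data.Sum using (inj₁; inj₂)
open import Function using (_∘_; Equivalence)
open import Relation.Binary.PropositionalEquality
open import Relation.Nullary using (¬_; proof)
open import Relation.Nullary.Decidable using (True)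
open import Relation.Nullary.Reflects using (Reflects; ofʸ; ofⁿ)

infix  10 ‵_
infix  8 ‵¬_
infixr 7 _‵∧_
infixr 4 _⊃_

data Schema (n : ℕ) : Set where
  var  : Fin n → Schema n
  ‵¬_  : Schema n → Schema n
  _‵∧_ : Schema n → Schema n → Schema n

_⊃_ : ∀ {n} → Schema n → Schema n → Schema n
p ⊃ q = ‵¬ (p ‵∧ ‵¬ q)

‵_ : ∀ m {n} {m<n : True (suc m ≤? n)} → Schema n
‵_ m {m<n = m<n} = var (#_ m {m<n = m<n})

⟦_⟧ᵇ : ∀ {n} → Schema n → Vec Bool n → Bool
⟦ var i ⟧ᵇ  bs = lookup bs i
⟦ ‵¬ p ⟧ᵇ   bs = not (⟦ p ⟧ᵇ bs)
⟦ p ‵∧ q ⟧ᵇ bs = ⟦ p ⟧ᵇ bs ∧ ⟦ q ⟧ᵇ bs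

everywhere : ∀ n → (Vec Bool n → Bool) → Bool
everywhere zero    f = f []
everywhere (suc n) f = everywhere n (f ∘ (true ∷_)) ∧ everywhere n (f ∘ (false ∷_))

everywhere-sound : ∀ n f → T (everywhere n f) → ∀ bs → T (f bs)
everywhere-sound zero    f t []           = t
everywhere-sound (suc n) f t (true ∷ bs)  =
  everywhere-sound n (f ∘ (true ∷_)) (proj₁ (Equivalence.to T-∧ t)) bs
everywhere-sound (suc n) f t (false ∷ bs) =
  everywhere-sound n (f ∘ (false ∷_)) (proj₂ (Equivalence.to T-∧ t)) bs

valid : ∀ {n} → Schema n → Bool
valid {n} p = everywhere n ⟦ p ⟧ᵇ

-- m ≟ n is defined from m ≡ᵇ n, so its proof component reflects the test used by rn and sub.
≡ᵇ-reflects : ∀ m n → Reflects (m ≡ n) (m ≡ᵇ n)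
≡ᵇ-reflects m n = proof (m ≟ n)

module _ (Pred : Set) (ar : Pred → ℕ) where
  open Syntax Pred ar

  -- Variables and substitution

  rn-id : ∀ x v → rn x x v ≡ v
  rn-id x v with v ≡ᵇ x | ≡ᵇ-reflects v x
  ... | true  | ofʸ refl = refl
  ... | false | _        = refl

  rn-self : ∀ y x → rn y x x ≡ y
  rn-self y x with x ≡ᵇ x | ≡ᵇ-reflects x x
  ... | true  | _       = refl
  ... | false | ofⁿ x≢x = ⊥-elim (x≢x refl)

  rn-≢ : ∀ y {x v} → x ≢ v → rn y x v ≡ v
  rn-≢ y {x} {v} x≢v with v ≡ᵇ x | ≡ᵇ-reflects v x
  ... | true  | ofʸ refl = ⊥-elim (x≢v refl)
  ... | false | _        = refl

  rn-avoids : ∀ {y x} v → x ≢ y → x ≢ rn y x v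
  rn-avoids {y} {x} v x≢y with v ≡ᵇ x | ≡ᵇ-reflects v x
  ... | true  | _       = x≢y
  ... | false | ofⁿ v≢x = v≢x ∘ sym

  rn-inverse : ∀ x {z v} → z ≢ v → rn x z (rn z x v) ≡ v
  rn-inverse x {z} {v} z≢v with v ≡ᵇ x | ≡ᵇ-reflects v x
  ... | true  | ofʸ refl = rn-self v z
  ... | false | _        = rn-≢ x z≢v

  map-id-All : ∀ {n} {f : Var → Var} {ys : Vec Var n} →
               VecAll.All (λ v → f v ≡ v) ys → Vec.map f ys ≡ ys
  map-id-All []       = refl
  map-id-All (p ∷ ps) = cong₂ _∷_ p (map-id-All ps)

  -- Unlike ¬ z ∈FV φ, Fresh z φ also excludes bound occurrences, as sub-inverse requires.
  Fresh : ∀ {E} → Var → Fm E → Set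
  Fresh z (atom P ys) = VecAll.All (z ≢_) ys
  Fresh z (eqv e a b) = z ≢ a × z ≢ b
  Fresh z (~ φ)       = Fresh z φ
  Fresh z (φ & ψ)     = Fresh z φ × Fresh z ψ
  Fresh z (K φ)       = Fresh z φ
  Fresh z (Wh w φ)    = z ≢ w × Fresh z φ

  maxVarᵛ : ∀ {n} → Vec Var n → Var
  maxVarᵛ []       = 0
  maxVarᵛ (v ∷ vs) = v ⊔ maxVarᵛ vs

  maxVar : ∀ {E} → Fm E → Var
  maxVar (atom P ys) = maxVarᵛ ys
  maxVar (eqv e a b) = a ⊔ b
  maxVar (~ φ)       = maxVar φ
  maxVar (φ & ψ)     = maxVar φ ⊔ maxVar ψ
  maxVar (K φ)       = maxVar φ
  maxVar (Wh w φ)    = w ⊔ maxVar φ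

  Fresh-above : ∀ {E z} (φ : Fm E) → maxVar φ < z → Fresh z φ
  Fresh-above {z = z} (atom P ys) = above ys
    where
    above : ∀ {n} (ys : Vec Var n) → maxVarᵛ ys < z → VecAll.All (z ≢_) ys
    above []       _ = []
    above (v ∷ vs) p = >⇒≢ (m⊔n<o⇒m<o v _ p) ∷ above vs (m⊔n<o⇒n<o v _ p)
  Fresh-above (eqv e a b) p = >⇒≢ (m⊔n<o⇒m<o a b p) , >⇒≢ (m⊔n<o⇒n<o a b p)
  Fresh-above (~ φ)       p = Fresh-above φ p
  Fresh-above (φ & ψ)     p = Fresh-above φ (m⊔n<o⇒m<o _ _ p) , Fresh-above ψ (m⊔n<o⇒n<o _ _ p)
  Fresh-above (K φ)       p = Fresh-above φ p
  Fresh-above (Wh w φ)    p = >⇒≢ (m⊔n<o⇒m<o w _ p) , Fresh-above φ (m⊔n<o⇒n<o w _ p)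

  fresh : ∀ {E} → Fm E → Var
  fresh φ = suc (maxVar φ)

  fresh-Fresh : ∀ {E} (φ : Fm E) → Fresh (fresh φ) φ
  fresh-Fresh φ = Fresh-above φ (n<1+n _)

  ∉FV-eqv : ∀ {E} {e : T E} {x a b} → x ≢ a → x ≢ b → ¬ x ∈FV eqv e a b
  ∉FV-eqv x≢a x≢b fv-eqˡ = x≢a refl
  ∉FV-eqv x≢a x≢b fv-eqʳ = x≢b refl

  ∉FV-~ : ∀ {E x} {φ : Fm E} → ¬ x ∈FV φ → ¬ x ∈FV (~ φ)
  ∉FV-~ x∉φ (fv-neg x∈φ) = x∉φ x∈φ

  ∉FV-& : ∀ {E x} {φ ψ : Fm E} → ¬ x ∈FV φ → ¬ x ∈FV ψ → ¬ x ∈FV (φ & ψ)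
  ∉FV-& x∉φ x∉ψ (fv-andˡ x∈φ) = x∉φ x∈φ
  ∉FV-& x∉φ x∉ψ (fv-andʳ x∈ψ) = x∉ψ x∈ψ

  ∉FV-⇒ : ∀ {E x} {φ ψ : Fm E} → ¬ x ∈FV φ → ¬ x ∈FV ψ → ¬ x ∈FV (φ ⇒ ψ)
  ∉FV-⇒ x∉φ x∉ψ = ∉FV-~ (∉FV-& x∉φ (∉FV-~ x∉ψ))

  ∉FV-K : ∀ {E x} {φ : Fm E} → ¬ x ∈FV φ → ¬ x ∈FV K φ
  ∉FV-K x∉φ (fv-K x∈φ) = x∉φ x∈φ

  ∉FV-Wh : ∀ {E x z} {φ : Fm E} → ¬ x ∈FV φ → ¬ x ∈FV Wh z φ
  ∉FV-Wh x∉φ (fv-Wh _ x∈φ) = x∉φ x∈φ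

  ∉FV-bound : ∀ {E x} {φ : Fm E} → ¬ x ∈FV Wh x φ
  ∉FV-bound (fv-Wh x≢x _) = x≢x refl

  Fresh⇒∉FV : ∀ {E z} (φ : Fm E) → Fresh z φ → ¬ z ∈FV φ
  Fresh⇒∉FV (atom P ys) f (fv-atom z∈ys) with VecAll.lookupAny f z∈ys
  ... | z≢v , z≡v = z≢v z≡v
  Fresh⇒∉FV (eqv e a b) (z≢a , z≢b)     = ∉FV-eqv z≢a z≢b
  Fresh⇒∉FV (~ φ)       f               = ∉FV-~ (Fresh⇒∉FV φ f)
  Fresh⇒∉FV (φ & ψ)     (f , g)         = ∉FV-& (Fresh⇒∉FV φ f) (Fresh⇒∉FV ψ g)
  Fresh⇒∉FV (K φ)       f               = ∉FV-K (Fresh⇒∉FV φ f)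
  Fresh⇒∉FV (Wh w φ)    (_ , f)         = ∉FV-Wh (Fresh⇒∉FV φ f)

  fresh-∉FV : ∀ {E} (φ : Fm E) → ¬ fresh φ ∈FV φ
  fresh-∉FV φ = Fresh⇒∉FV φ (fresh-Fresh φ)

  ∉FV-sub : ∀ {E z x} (φ : Fm E) → x ≢ z → ¬ x ∈FV sub z x φ
  ∉FV-sub (atom P ys) x≢z (fv-atom x∈ys) with satisfied (VecAny.map⁻ x∈ys)
  ... | v , x≡rn = rn-avoids v x≢z x≡rn
  ∉FV-sub (eqv e a b) x≢z = ∉FV-eqv (rn-avoids a x≢z) (rn-avoids b x≢z)
  ∉FV-sub (~ φ)       x≢z = ∉FV-~ (∉FV-sub φ x≢z)
  ∉FV-sub (φ & ψ)     x≢z = ∉FV-& (∉FV-sub φ x≢z) (∉FV-sub ψ x≢z)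
  ∉FV-sub (K φ)       x≢z = ∉FV-K (∉FV-sub φ x≢z)
  ∉FV-sub {x = x} (Wh w φ) x≢z with w ≡ᵇ x | ≡ᵇ-reflects w x
  ... | true  | ofʸ refl = ∉FV-bound
  ... | false | _        = ∉FV-Wh (∉FV-sub φ x≢z)

  sub-id : ∀ {E} x (φ : Fm E) → sub x x φ ≡ φ
  sub-id x (atom P ys) = cong (atom P) (trans (map-cong (rn-id x) ys) (map-id ys))
  sub-id x (eqv e a b) = cong₂ (eqv e) (rn-id x a) (rn-id x b)
  sub-id x (~ φ)       = cong ~_ (sub-id x φ)
  sub-id x (φ & ψ)     = cong₂ _&_ (sub-id x φ) (sub-id x ψ)
  sub-id x (K φ)       = cong K (sub-id x φ)
  sub-id x (Wh z φ) with z ≡ᵇ x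
  ... | true  = refl
  ... | false = cong (Wh z) (sub-id x φ)

  sub-fresh : ∀ {E} y {z} (φ : Fm E) → Fresh z φ → sub y z φ ≡ φ
  sub-fresh y (atom P ys) f             = cong (atom P) (map-id-All (VecAll.map (rn-≢ y) f))
  sub-fresh y (eqv e a b) (z≢a , z≢b)   = cong₂ (eqv e) (rn-≢ y z≢a) (rn-≢ y z≢b)
  sub-fresh y (~ φ)       f             = cong ~_ (sub-fresh y φ f)
  sub-fresh y (φ & ψ)     (f , g)       = cong₂ _&_ (sub-fresh y φ f) (sub-fresh y ψ g)
  sub-fresh y (K φ)       f             = cong K (sub-fresh y φ f)
  sub-fresh y {z} (Wh w φ) (_ , f) with w ≡ᵇ z
  ... | true  = refl
  ... | false = cong (Wh w) (sub-fresh y φ f)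

  sub-inverse : ∀ {E} x {z} (φ : Fm E) → Fresh z φ → sub x z (sub z x φ) ≡ φ
  sub-inverse x (atom P ys) f =
    cong (atom P) (trans (sym (map-∘ _ _ ys)) (map-id-All (VecAll.map (rn-inverse x) f)))
  sub-inverse x (eqv e a b) (z≢a , z≢b) = cong₂ (eqv e) (rn-inverse x z≢a) (rn-inverse x z≢b)
  sub-inverse x (~ φ)       f           = cong ~_ (sub-inverse x φ f)
  sub-inverse x (φ & ψ)     (f , g)     = cong₂ _&_ (sub-inverse x φ f) (sub-inverse x ψ g)
  sub-inverse x (K φ)       f           = cong K (sub-inverse x φ f)
  sub-inverse x {z} (Wh w φ) (z≢w , f) with w ≡ᵇ x
  ... | true with w ≡ᵇ z
  ...   | true  = refl
  ...   | false = cong (Wh w) (sub-fresh x φ f)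
  sub-inverse x {z} (Wh w φ) (z≢w , f) | false with w ≡ᵇ z | ≡ᵇ-reflects w z
  ...   | true  | ofʸ refl = ⊥-elim (z≢w refl)
  ...   | false | _        = cong (Wh w) (sub-inverse x φ f)

  Adm-id : ∀ {E} x (φ : Fm E) → Adm x x φ
  Adm-id x (atom P ys) = tt
  Adm-id x (eqv e a b) = tt
  Adm-id x (~ φ)       = Adm-id x φ
  Adm-id x (φ & ψ)     = Adm-id x φ , Adm-id x ψ
  Adm-id x (K φ)       = Adm-id x φ
  Adm-id x (Wh z φ) with z ≡ᵇ x | ≡ᵇ-reflects z x
  ... | true  | ofʸ refl = inj₁ ∉FV-bound
  ... | false | ofⁿ z≢x  = inj₂ (z≢x , Adm-id x φ)

  Adm-for-fresh : ∀ {E} y {z} (φ : Fm E) → Fresh z φ → Adm y z φ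
  Adm-for-fresh y (atom P ys) f       = tt
  Adm-for-fresh y (eqv e a b) f       = tt
  Adm-for-fresh y (~ φ)       f       = Adm-for-fresh y φ f
  Adm-for-fresh y (φ & ψ)     (f , g) = Adm-for-fresh y φ f , Adm-for-fresh y ψ g
  Adm-for-fresh y (K φ)       f       = Adm-for-fresh y φ f
  Adm-for-fresh y (Wh w φ)    f       = inj₁ (Fresh⇒∉FV (Wh w φ) f)

  fresh-Adm : ∀ {E z} x (φ : Fm E) → Fresh z φ → Adm z x φ
  fresh-Adm x (atom P ys) f         = tt
  fresh-Adm x (eqv e a b) f         = tt
  fresh-Adm x (~ φ)       f         = fresh-Adm x φ f
  fresh-Adm x (φ & ψ)     (f , g)   = fresh-Adm x φ f , fresh-Adm x ψ g
  fresh-Adm x (K φ)       f         = fresh-Adm x φ f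
  fresh-Adm x (Wh w φ)    (z≢w , f) = inj₂ ((z≢w ∘ sym) , fresh-Adm x φ f)

  Adm-inverse : ∀ {E} x {z} (φ : Fm E) → Fresh z φ → Adm x z (sub z x φ)
  Adm-inverse x (atom P ys) f       = tt
  Adm-inverse x (eqv e a b) f       = tt
  Adm-inverse x (~ φ)       f       = Adm-inverse x φ f
  Adm-inverse x (φ & ψ)     (f , g) = Adm-inverse x φ f , Adm-inverse x ψ g
  Adm-inverse x (K φ)       f       = Adm-inverse x φ f
  Adm-inverse x (Wh w φ)    f with w ≡ᵇ x | ≡ᵇ-reflects w x
  ... | true  | _       = inj₁ (Fresh⇒∉FV (Wh w φ) f)
  ... | false | ofⁿ w≢x = inj₂ (w≢x , Adm-inverse x φ (proj₂ f))

  -- Derivations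

  ⟦_⟧ : ∀ {n E} → Schema n → Vec (Fm E) n → Fm E
  ⟦ var i ⟧  as = lookup as i
  ⟦ ‵¬ p ⟧   as = ~ ⟦ p ⟧ as
  ⟦ p ‵∧ q ⟧ as = ⟦ p ⟧ as & ⟦ q ⟧ as

  eval-⟦⟧ : ∀ {n E} (v : Fm E → Bool) (p : Schema n) as →
            eval v (⟦ p ⟧ as) ≡ ⟦ p ⟧ᵇ (Vec.map (eval v) as)
  eval-⟦⟧ v (var i)  as = sym (lookup-map i (eval v) as)
  eval-⟦⟧ v (‵¬ p)   as = cong not (eval-⟦⟧ v p as)
  eval-⟦⟧ v (p ‵∧ q) as = cong₂ _∧_ (eval-⟦⟧ v p as) (eval-⟦⟧ v q as)

  valid⇒Taut : ∀ {n E} (p : Schema n) (as : Vec (Fm E) n) → T (valid p) → Taut (⟦ p ⟧ as)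
  valid⇒Taut {n} p as ok v =
    trans (eval-⟦⟧ v p as) (Equivalence.to T-≡ (everywhere-sound n ⟦ p ⟧ᵇ ok (Vec.map (eval v) as)))

  ⊢-mono : ∀ {E} {L L' : Logic E} → (∀ {φ} → Ax L φ → L' ⊢ φ) → (∀ {φ ψ} → Rl L φ ψ → Rl L' φ ψ) →
           ∀ {φ} → L ⊢ φ → L' ⊢ φ
  ⊢-mono axs rls (ax a)     = axs a
  ⊢-mono axs rls (mp d e)   = mp (⊢-mono axs rls d) (⊢-mono axs rls e)
  ⊢-mono axs rls (nec d)    = nec (⊢-mono axs rls d)
  ⊢-mono axs rls (rule r d) = rule (rls r) (⊢-mono axs rls d)

  ⊕-≐ : ∀ {E} {L : Logic E} {χ χ' : Fm E → Set} →
        (∀ {φ} → χ φ → (L ⊕ χ') ⊢ φ) → (∀ {φ} → χ' φ → (L ⊕ χ) ⊢ φ) → (L ⊕ χ) ≐ (L ⊕ χ')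
  ⊕-≐ {L = L} χ⊢ χ'⊢ φ = ⊢-mono (extend χ⊢) (λ r → r) , ⊢-mono (extend χ'⊢) (λ r → r)
    where
    extend : ∀ {χ χ'} → (∀ {φ} → χ φ → (L ⊕ χ') ⊢ φ) → ∀ {φ} → Ax (L ⊕ χ) φ → (L ⊕ χ') ⊢ φ
    extend _   (inj₁ a) = ax (inj₁ a)
    extend χ⊢ (inj₂ c) = χ⊢ c

  module S42Reasoning {E} (L : Logic E) (s42 : ∀ {φ} → S42Ax φ → Ax L φ) where

    tautology : ∀ {n} (p : Schema n) (as : Vec (Fm E) n) {_ : T (valid p)} → L ⊢ ⟦ p ⟧ as
    tautology p as {ok} = ax (s42 (taut (valid⇒Taut p as ok)))

    ⇒-trans : ∀ {a b c} → L ⊢ (a ⇒ b) → L ⊢ (b ⇒ c) → L ⊢ (a ⇒ c)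
    ⇒-trans {a} {b} {c} d e =
      mp (mp (tautology ((‵ 0 ⊃ ‵ 1) ⊃ (‵ 1 ⊃ ‵ 2) ⊃ (‵ 0 ⊃ ‵ 2)) (a ∷ b ∷ c ∷ [])) d) e

    ⇒-mp : ∀ {a b c} → L ⊢ (a ⇒ (b ⇒ c)) → L ⊢ (a ⇒ b) → L ⊢ (a ⇒ c)
    ⇒-mp {a} {b} {c} d e =
      mp (mp (tautology ((‵ 0 ⊃ ‵ 1 ⊃ ‵ 2) ⊃ (‵ 0 ⊃ ‵ 1) ⊃ (‵ 0 ⊃ ‵ 2)) (a ∷ b ∷ c ∷ [])) d) e

    weaken : ∀ {a b} → L ⊢ b → L ⊢ (a ⇒ b)
    weaken {a} {b} = mp (tautology (‵ 1 ⊃ ‵ 0 ⊃ ‵ 1) (a ∷ b ∷ []))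

    contrapose : ∀ {a b} → L ⊢ (a ⇒ b) → L ⊢ (~ b ⇒ ~ a)
    contrapose {a} {b} = mp (tautology ((‵ 0 ⊃ ‵ 1) ⊃ (‵¬ ‵ 1 ⊃ ‵¬ ‵ 0)) (a ∷ b ∷ []))

    K-distrib : ∀ {a b} → L ⊢ (K (a ⇒ b) ⇒ (K a ⇒ K b))
    K-distrib {a} {b} = ax (s42 (axK a b))

    K-4 : ∀ {a} → L ⊢ (K a ⇒ K (K a))
    K-4 {a} = ax (s42 (ax4 a))

    K-mono : ∀ {a b} → L ⊢ (a ⇒ b) → L ⊢ (K a ⇒ K b)
    K-mono d = mp K-distrib (nec d)

    dK-mono : ∀ {a b} → L ⊢ (a ⇒ b) → L ⊢ (dK a ⇒ dK b)
    dK-mono = contrapose ∘ K-mono ∘ contrapose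

    B-mono : ∀ {a b} → L ⊢ (a ⇒ b) → L ⊢ (B a ⇒ B b)
    B-mono = dK-mono ∘ K-mono

    B⇒KB : ∀ {φ} → L ⊢ (B φ ⇒ K (B φ))
    B⇒KB {φ} = ⇒-trans (dK-mono K-4) (ax (s42 (ax2 (K φ))))

    ¬B⇒K¬B : ∀ {φ} → L ⊢ (~ B φ ⇒ K (~ B φ))
    ¬B⇒K¬B {φ} = ⇒-trans (tautology (‵¬ ‵¬ ‵ 0 ⊃ ‵ 0) (K (~ K φ) ∷ []))
                         (⇒-trans K-4 (K-mono (tautology (‵ 0 ⊃ ‵¬ ‵¬ ‵ 0) (K (~ K φ) ∷ []))))

    K-⇒-introspective : ∀ {a b} → L ⊢ (a ⇒ K a) → L ⊢ (K (a ⇒ b) ⇒ (a ⇒ K b))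
    K-⇒-introspective {a} {b} d =
      mp (mp (tautology ((‵ 0 ⊃ ‵ 1) ⊃ (‵ 2 ⊃ ‵ 1 ⊃ ‵ 3) ⊃ (‵ 2 ⊃ ‵ 0 ⊃ ‵ 3))
                        (a ∷ K a ∷ K (a ⇒ b) ∷ K b ∷ []))
             d)
         K-distrib

    TB-introspective : ∀ {φ} → L ⊢ ((B φ & φ) ⇒ K φ) → L ⊢ ((B φ & φ) ⇒ K (B φ & φ))
    TB-introspective {φ} d =
      mp (mp (mp (tautology (((‵ 0 ‵∧ ‵ 1) ⊃ ‵ 2) ⊃ (‵ 0 ⊃ ‵ 3) ⊃ (‵ 3 ⊃ ‵ 2 ⊃ ‵ 4)
                              ⊃ ((‵ 0 ‵∧ ‵ 1) ⊃ ‵ 4))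
                            (B φ ∷ φ ∷ K φ ∷ K (B φ) ∷ K (B φ & φ) ∷ []))
                 d) B⇒KB) K-and
      where
      K-and : L ⊢ (K (B φ) ⇒ (K φ ⇒ K (B φ & φ)))
      K-and = ⇒-trans (K-mono (tautology (‵ 0 ⊃ ‵ 1 ⊃ (‵ 0 ‵∧ ‵ 1)) (B φ ∷ φ ∷ []))) K-distrib

    -- Knowing Bφ ∧ φ → Kφ, a true Bφ → φ holds either because ¬Bφ (which is known) or because Kφ.
    FS-known : ∀ {h φ} → L ⊢ (h ⇒ ((B φ & φ) ⇒ K φ)) → L ⊢ (h ⇒ ((B φ ⇒ φ) ⇒ K (B φ ⇒ φ)))
    FS-known {h} {φ} d =
      mp (mp (mp (mp (tautology ((‵ 0 ⊃ (‵ 1 ‵∧ ‵ 2) ⊃ ‵ 3) ⊃ (‵¬ ‵ 1 ⊃ ‵ 4) ⊃ (‵ 4 ⊃ ‵ 5) ⊃ (‵ 3 ⊃ ‵ 5)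
                                  ⊃ (‵ 0 ⊃ (‵ 1 ⊃ ‵ 2) ⊃ ‵ 5))
                                (h ∷ B φ ∷ φ ∷ K φ ∷ K (~ B φ) ∷ K (B φ ⇒ φ) ∷ []))
                     d) ¬B⇒K¬B)
             (K-mono (tautology (‵¬ ‵ 0 ⊃ ‵ 0 ⊃ ‵ 1) (B φ ∷ φ ∷ []))))
         (K-mono (tautology (‵ 1 ⊃ ‵ 0 ⊃ ‵ 1) (B φ ∷ φ ∷ [])))

    -- The vacuous hypothesis ψ → ψ is what lets a rule with a one-step context act under [K].
    rule-under-K : ∀ {ψ a b} → (L ⊢ (ψ ⇒ K ((ψ ⇒ ψ) ⇒ a)) → L ⊢ (ψ ⇒ K ((ψ ⇒ ψ) ⇒ b))) →
                   L ⊢ (ψ ⇒ K a) → L ⊢ (ψ ⇒ K b)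
    rule-under-K {ψ} {a} {b} r d =
      ⇒-trans (r (⇒-trans d (K-mono (tautology (‵ 1 ⊃ (‵ 0 ⊃ ‵ 0) ⊃ ‵ 1) (ψ ∷ a ∷ [])))))
              (K-mono (tautology (((‵ 0 ⊃ ‵ 0) ⊃ ‵ 1) ⊃ ‵ 1) (ψ ∷ b ∷ [])))

  module KwhtoTBReasoning {E} (L : Logic E) (s42 : ∀ {φ} → S42Ax φ → Ax L φ)
                          (kwhtoTB : ∀ {φ ψ} → KwhtoTB φ ψ → Rl L φ ψ) where
    open S42Reasoning L s42

    KwhtoTB₀ : ∀ {x ψ φ} → ¬ x ∈FV ψ → L ⊢ (ψ ⇒ ~ (B φ & φ)) → L ⊢ (ψ ⇒ ~ Wh x φ)
    KwhtoTB₀ {x} {ψ} {φ} x∉ψ = rule (kwhtoTB (inst x φ ψ [] (x∉ψ ∷ [])))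

    Wh⇒body : ∀ {x φ} → ¬ x ∈FV φ → L ⊢ (Wh x φ ⇒ φ)
    Wh⇒body {x} {φ} x∉φ =
      mp (tautology ((‵¬ ‵ 1 ⊃ ‵¬ ‵ 0) ⊃ (‵ 0 ⊃ ‵ 1)) (Wh x φ ∷ φ ∷ []))
         (KwhtoTB₀ (∉FV-~ x∉φ) (tautology (‵¬ ‵ 1 ⊃ ‵¬ (‵ 0 ‵∧ ‵ 1)) (B φ ∷ φ ∷ [])))

    Wh-introspection : ∀ {x φ} → L ⊢ (Wh x φ ⇒ ((B φ & φ) ⇒ K (Wh x φ))) → L ⊢ (Wh x φ ⇒ K (Wh x φ))
    Wh-introspection {x} {φ} d =
      mp (tautology (((‵ 0 ‵∧ ‵¬ ‵ 1) ⊃ ‵¬ ‵ 0) ⊃ (‵ 0 ⊃ ‵ 1)) (Wh x φ ∷ K (Wh x φ) ∷ []))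
         (KwhtoTB₀ (∉FV-& ∉FV-bound (∉FV-~ (∉FV-K ∉FV-bound)))
           (mp (tautology ((‵ 0 ⊃ ‵ 1 ⊃ ‵ 2) ⊃ ((‵ 0 ‵∧ ‵¬ ‵ 2) ⊃ ‵¬ ‵ 1))
                          (Wh x φ ∷ (B φ & φ) ∷ K (Wh x φ) ∷ []))
               d))

  module tBMS-Extension (χ : Fm false → Set) where

    L : Logic false
    L = S42-tBMS ⊕ χ

    open S42Reasoning L (λ a → inj₁ (inj₁ a))
    open KwhtoTBReasoning L (λ a → inj₁ (inj₁ a)) (λ r → r)

    TB⇒Wh : ∀ {x φ} → L ⊢ ((B φ & φ) ⇒ Wh x φ)
    TB⇒Wh {x} {φ} = subst (λ t → L ⊢ (t ⇒ Wh x φ)) (sub-id x (B φ & φ))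
                          (ax (inj₁ (inj₂ (inst x x φ (Adm-id x φ)))))

    KwhPI-from-TBtoK : ∀ {x φ} → L ⊢ ((B φ & φ) ⇒ K φ) → L ⊢ (Wh x φ ⇒ K (Wh x φ))
    KwhPI-from-TBtoK tbk = Wh-introspection (weaken (⇒-trans (TB-introspective tbk) (K-mono TB⇒Wh)))

    TBtoK-from-KwhPI : ∀ {x φ} → ¬ x ∈FV φ → L ⊢ (Wh x φ ⇒ K (Wh x φ)) → L ⊢ ((B φ & φ) ⇒ K φ)
    TBtoK-from-KwhPI x∉φ pi = ⇒-trans TB⇒Wh (⇒-trans pi (K-mono (Wh⇒body x∉φ)))

  module tBMS-FS-Extension (χ : Fm false → Set) where

    L : Logic false
    L = S42-tBMS-FS ⊕ χ

    open S42Reasoning L (λ a → inj₁ (inj₁ a))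
    open KwhtoTBReasoning L (λ a → inj₁ (inj₁ a)) inj₁

    Wh⇒FS : ∀ {x φ} → L ⊢ (Wh x φ ⇒ (B φ ⇒ φ))
    Wh⇒FS {x} {φ} = subst (λ t → L ⊢ (Wh x φ ⇒ t)) (sub-id x (B φ ⇒ φ))
                          (ax (inj₁ (inj₂ (inj₁ (inst x x φ (Adm-id x φ))))))

    FSBtoKwh₀ : ∀ {x ψ φ} → ¬ x ∈FV ψ → L ⊢ (ψ ⇒ (B φ ⇒ φ)) → L ⊢ (ψ ⇒ (B φ ⇒ Wh x φ))
    FSBtoKwh₀ {x} {ψ} {φ} x∉ψ d =
      subst (λ t → L ⊢ (ψ ⇒ (t ⇒ Wh x φ))) (sub-id x (B φ))
            (rule (inj₂ (inst x x φ ψ [] (x∉ψ ∷ []) (Adm-id x φ))) d)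

    FSBtoKwh₁ : ∀ {x ψ φ} → ¬ x ∈FV ψ → L ⊢ (ψ ⇒ K (B φ ⇒ φ)) → L ⊢ (ψ ⇒ K (B φ ⇒ Wh x φ))
    FSBtoKwh₁ {x} {ψ} {φ} x∉ψ = rule-under-K λ d →
      subst (λ t → L ⊢ (ψ ⇒ K ((ψ ⇒ ψ) ⇒ (t ⇒ Wh x φ)))) (sub-id x (B φ))
            (rule (inj₂ (inst x x φ ψ ((ψ ⇒ ψ) ∷ []) (x∉ψ ∷ ∉FV-⇒ x∉ψ x∉ψ ∷ []) (Adm-id x φ))) d)

    TB⇒Wh : ∀ {x φ} → ¬ x ∈FV φ → L ⊢ ((B φ & φ) ⇒ Wh x φ)
    TB⇒Wh {x} {φ} x∉φ =
      mp (tautology ((‵ 1 ⊃ ‵ 0 ⊃ ‵ 2) ⊃ ((‵ 0 ‵∧ ‵ 1) ⊃ ‵ 2)) (B φ ∷ φ ∷ Wh x φ ∷ []))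
         (FSBtoKwh₀ x∉φ (tautology (‵ 0 ⊃ ‵ 1 ⊃ ‵ 0) (φ ∷ B φ ∷ [])))

    KwhPI-from-TBtoK : ∀ {x φ} → L ⊢ ((B φ & φ) ⇒ K φ) → L ⊢ (Wh x φ ⇒ K (Wh x φ))
    KwhPI-from-TBtoK {x} {φ} tbk =
      Wh-introspection (mp (tautology ((‵ 0 ⊃ ‵ 1 ⊃ ‵ 3) ⊃ (‵ 0 ⊃ (‵ 1 ‵∧ ‵ 2) ⊃ ‵ 3))
                                      (Wh x φ ∷ B φ ∷ φ ∷ K (Wh x φ) ∷ []))
                           (⇒-trans Wh-known-from-B (K-⇒-introspective B⇒KB)))
      where
      FS-known-under-Wh : L ⊢ (Wh x φ ⇒ K (B φ ⇒ φ))
      FS-known-under-Wh = ⇒-mp (FS-known (weaken tbk)) Wh⇒FS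
      Wh-known-from-B : L ⊢ (Wh x φ ⇒ K (B φ ⇒ Wh x φ))
      Wh-known-from-B = FSBtoKwh₁ ∉FV-bound FS-known-under-Wh

    TBtoK-from-KwhPI : ∀ {x φ} → ¬ x ∈FV φ → L ⊢ (Wh x φ ⇒ K (Wh x φ)) → L ⊢ ((B φ & φ) ⇒ K φ)
    TBtoK-from-KwhPI x∉φ pi = ⇒-trans (TB⇒Wh x∉φ) (⇒-trans pi (K-mono (Wh⇒body x∉φ)))

  module KMS-FS-Extension (χ : Fm true → Set) where

    L : Logic true
    L = S42≈-KMS-FS ⊕ χ

    open S42Reasoning L (λ a → inj₁ (inj₁ a))

    KwhtoFS-ax : ∀ {x y φ} → Adm y x φ → L ⊢ (Wh x φ ⇒ sub y x (B φ ⇒ φ))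
    KwhtoFS-ax {x} {y} {φ} adm = ax (inj₁ (inj₂ (inj₁ (inst x y φ adm))))

    EqAx-ax : ∀ {φ} → EqAx φ → L ⊢ φ
    EqAx-ax a = ax (inj₁ (inj₂ (inj₂ (inj₂ a))))

    KwhtoK₀ : ∀ {x ψ φ} → ¬ x ∈FV ψ → L ⊢ (ψ ⇒ ~ K φ) → L ⊢ (ψ ⇒ ~ Wh x φ)
    KwhtoK₀ {x} {ψ} {φ} x∉ψ = rule (inj₁ (inst x φ ψ [] (x∉ψ ∷ [])))

    FSKtoKwh₀ : ∀ {x y ψ φ} → ¬ x ∈FV ψ → Adm y x φ →
                L ⊢ (ψ ⇒ (B φ ⇒ φ)) → L ⊢ (ψ ⇒ (sub y x (K φ) ⇒ Wh x φ))
    FSKtoKwh₀ {x} {y} {ψ} {φ} x∉ψ adm = rule (inj₂ (inst x y φ ψ [] (x∉ψ ∷ []) adm))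

    FSKtoKwh₁ : ∀ {x y ψ φ} → ¬ x ∈FV ψ → Adm y x φ →
                L ⊢ (ψ ⇒ K (B φ ⇒ φ)) → L ⊢ (ψ ⇒ K (sub y x (K φ) ⇒ Wh x φ))
    FSKtoKwh₁ {x} {y} {ψ} {φ} x∉ψ adm =
      rule-under-K (rule (inj₂ (inst x y φ ψ ((ψ ⇒ ψ) ∷ []) (x∉ψ ∷ ∉FV-⇒ x∉ψ x∉ψ ∷ []) adm)))

    Wh⇒FS : ∀ {x φ} → L ⊢ (Wh x φ ⇒ (B φ ⇒ φ))
    Wh⇒FS {x} {φ} = subst (λ t → L ⊢ (Wh x φ ⇒ t)) (sub-id x (B φ ⇒ φ)) (KwhtoFS-ax (Adm-id x φ))

    Wh-rename : ∀ {x z φ} → Fresh z (Wh x φ) → L ⊢ (Wh x φ ⇒ Wh z (sub z x φ))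
    Wh-rename {x} {z} {φ} f@(z≢x , fφ) =
      mp (tautology (((‵ 0 ‵∧ ‵¬ ‵ 1) ⊃ ‵¬ ‵ 0) ⊃ (‵ 0 ⊃ ‵ 1)) (Wh x φ ∷ Wh z (sub z x φ) ∷ []))
         (KwhtoK₀ (∉FV-& ∉FV-bound (∉FV-~ (∉FV-Wh (∉FV-sub φ (≢-sym z≢x)))))
           (mp (tautology ((‵ 0 ⊃ ‵ 2 ⊃ ‵ 1) ⊃ ((‵ 0 ‵∧ ‵¬ ‵ 1) ⊃ ‵¬ ‵ 2))
                          (Wh x φ ∷ Wh z (sub z x φ) ∷ K φ ∷ []))
               renamed-from-K))
      where
      renamed-from-K : L ⊢ (Wh x φ ⇒ (K φ ⇒ Wh z (sub z x φ)))
      renamed-from-K =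
        subst (λ t → L ⊢ (Wh x φ ⇒ (K t ⇒ Wh z (sub z x φ)))) (sub-inverse x φ fφ)
              (FSKtoKwh₀ (Fresh⇒∉FV (Wh x φ) f) (Adm-inverse x φ fφ) (KwhtoFS-ax (fresh-Adm x φ fφ)))

    -- The witness is [K^MS_FS]^z (x ≈ z → φ) for a fresh z: instantiating z by y, ¬ x ≈ y makes it
    -- known by eq-neq; instantiating z by x, it reduces to φ by reflexivity.
    NeqTBtoK-from-KwhPI : ∀ {x y φ} → (∀ {z ψ} → L ⊢ (Wh z ψ ⇒ K (Wh z ψ))) →
                          L ⊢ (~ eqv tt x y ⇒ ((B φ & φ) ⇒ K φ))
    NeqTBtoK-from-KwhPI {x} {y} {φ} pi =
      mp (mp (tautology (((‵ 0 ‵∧ ‵¬ ‵ 1) ⊃ ‵ 2) ⊃ (‵ 2 ⊃ ‵ 3 ⊃ ‵ 4) ⊃ (‵¬ ‵ 1 ⊃ (‵ 3 ‵∧ ‵ 0) ⊃ ‵ 4))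
                        (φ ∷ eqv tt x y ∷ W ∷ B φ ∷ K φ ∷ []))
             true-and-distinct⇒W)
         (⇒-trans pi (⇒-trans (K-mono W⇒FS) (K-⇒-introspective B⇒KB)))
      where
      z : Var
      z = fresh (φ & eqv tt x y)
      fresh-z : Fresh z (φ & eqv tt x y)
      fresh-z = fresh-Fresh (φ & eqv tt x y)
      fφ : Fresh z φ
      fφ = proj₁ fresh-z
      ψ : Fm true
      ψ = eqv tt x z ⇒ φ
      W : Fm true
      W = Wh z ψ
      sub-ψ : ∀ w → sub w z ψ ≡ (eqv tt x w ⇒ φ)
      sub-ψ w rewrite rn-≢ w (proj₁ (proj₂ fresh-z)) | rn-self w z | sub-fresh w φ fφ = refl
      Adm-ψ : ∀ w → Adm w z ψ
      Adm-ψ w = tt , Adm-for-fresh w φ fφ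

      true-and-distinct⇒W : L ⊢ ((φ & ~ eqv tt x y) ⇒ W)
      true-and-distinct⇒W =
        mp (mp (mp (tautology (((‵ 0 ‵∧ ‵¬ ‵ 1) ⊃ ‵ 2 ⊃ ‵ 3) ⊃ (‵¬ ‵ 1 ⊃ ‵ 4) ⊃ (‵ 4 ⊃ ‵ 2)
                                 ⊃ ((‵ 0 ‵∧ ‵¬ ‵ 1) ⊃ ‵ 3))
                              (φ ∷ eqv tt x y ∷ K (eqv tt x y ⇒ φ) ∷ W ∷ K (~ eqv tt x y) ∷ []))
                   (subst (λ t → L ⊢ ((φ & ~ eqv tt x y) ⇒ (K t ⇒ W))) (sub-ψ y)
                          (FSKtoKwh₀ (Fresh⇒∉FV (φ & ~ eqv tt x y) fresh-z) (Adm-ψ y)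
                                     (tautology ((‵ 0 ‵∧ ‵¬ ‵ 1) ⊃ ‵ 2 ⊃ ‵ 3 ⊃ ‵ 0)
                                                (φ ∷ eqv tt x y ∷ B ψ ∷ eqv tt x z ∷ [])))))
               (EqAx-ax (eq-neq x y)))
           (K-mono (tautology (‵¬ ‵ 0 ⊃ ‵ 0 ⊃ ‵ 1) (eqv tt x y ∷ φ ∷ [])))

      W⇒FS : L ⊢ (W ⇒ (B φ ⇒ φ))
      W⇒FS =
        mp (mp (mp (tautology ((‵ 0 ⊃ ‵ 2 ⊃ ‵ 3 ⊃ ‵ 4) ⊃ (‵ 1 ⊃ ‵ 2) ⊃ ‵ 3 ⊃ (‵ 0 ⊃ ‵ 1 ⊃ ‵ 4))
                              (W ∷ B φ ∷ B (eqv tt x x ⇒ φ) ∷ eqv tt x x ∷ φ ∷ []))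
                   (subst (λ t → L ⊢ (W ⇒ (B t ⇒ t))) (sub-ψ x) (KwhtoFS-ax (Adm-ψ x))))
               (B-mono (tautology (‵ 0 ⊃ ‵ 1 ⊃ ‵ 0) (φ ∷ eqv tt x x ∷ []))))
           (EqAx-ax (eq-refl x))

    -- Rename x to a fresh z, so that K φ[z/x] may appear in the context of the rules for x.
    -- If z ≈ x, then K φ[z/x] gives K φ; otherwise the hypothesis makes B φ → φ known.
    KwhPI-from-NeqTBtoK : ∀ {x φ} → (∀ {z} → L ⊢ (~ eqv tt z x ⇒ ((B φ & φ) ⇒ K φ))) →
                          L ⊢ (Wh x φ ⇒ K (Wh x φ))
    KwhPI-from-NeqTBtoK {x} {φ} neq =
      mp (mp (tautology ((‵ 0 ⊃ ‵ 1) ⊃ ((‵ 0 ‵∧ ‵¬ ‵ 2) ⊃ ‵¬ ‵ 1) ⊃ (‵ 0 ⊃ ‵ 2))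
                        (W ∷ Wh z φ' ∷ K W ∷ []))
             (Wh-rename f))
         (KwhtoK₀ (Fresh⇒∉FV (W & ~ K W) (f , f))
           (mp (tautology (((‵ 0 ‵∧ ‵ 1) ⊃ ‵ 2) ⊃ ((‵ 0 ‵∧ ‵¬ ‵ 2) ⊃ ‵¬ ‵ 1)) (W ∷ K φ' ∷ K W ∷ []))
               W∧Kφ'⇒KW))
      where
      W : Fm true
      W = Wh x φ
      z : Var
      z = fresh W
      f : Fresh z W
      f = fresh-Fresh W
      φ' : Fm true
      φ' = sub z x φ

      FS-known-under-W∧Kφ' : L ⊢ ((W & K φ') ⇒ K (B φ ⇒ φ))
      FS-known-under-W∧Kφ' =
        mp (mp (mp (mp (tautology ((‵¬ ‵ 2 ⊃ (‵ 4 ⊃ ‵ 5) ⊃ ‵ 6) ⊃ (‵ 2 ⊃ ‵ 1 ⊃ ‵ 3) ⊃ (‵ 3 ⊃ ‵ 6)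
                                     ⊃ (‵ 0 ⊃ ‵ 4 ⊃ ‵ 5) ⊃ ((‵ 0 ‵∧ ‵ 1) ⊃ ‵ 6))
                                  (W ∷ K φ' ∷ eqv tt z x ∷ K φ ∷ B φ ∷ φ ∷ K (B φ ⇒ φ) ∷ []))
                       (FS-known neq))
                   (subst (λ t → L ⊢ (eqv tt z x ⇒ (K φ' ⇒ t))) (sub-id x (K φ))
                          (EqAx-ax (eq-leib z x x (K φ) (fresh-Adm x φ (proj₂ f)) (Adm-id x φ)))))
               (K-mono (tautology (‵ 1 ⊃ ‵ 0 ⊃ ‵ 1) (B φ ∷ φ ∷ []))))
           Wh⇒FS

      W∧Kφ'⇒KW : L ⊢ ((W & K φ') ⇒ K W)
      W∧Kφ'⇒KW =
        ⇒-mp (⇒-trans (FSKtoKwh₁ (∉FV-& ∉FV-bound (∉FV-K (∉FV-sub φ (≢-sym (proj₁ f)))))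
                                 (fresh-Adm x φ (proj₂ f)) FS-known-under-W∧Kφ')
                      (K-⇒-introspective K-4))
             (tautology ((‵ 0 ‵∧ ‵ 1) ⊃ ‵ 1) (W ∷ K φ' ∷ []))

  tBMS-KwhPI≐TBtoK : (S42-tBMS ⊕ KwhPI) ≐ (S42-tBMS ⊕ TBtoK)
  tBMS-KwhPI≐TBtoK = ⊕-≐ (λ { (inst _ φ) → KwhPI-from-TBtoK (ax (inj₂ (inst φ))) })
                         (λ { (inst φ) → TBtoK-from-KwhPI (fresh-∉FV φ) (ax (inj₂ (inst _ φ))) })
    where
    open tBMS-Extension TBtoK using (KwhPI-from-TBtoK)
    open tBMS-Extension KwhPI using (TBtoK-from-KwhPI)

  tBMS-FS-KwhPI≐TBtoK : (S42-tBMS-FS ⊕ KwhPI) ≐ (S42-tBMS-FS ⊕ TBtoK)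
  tBMS-FS-KwhPI≐TBtoK = ⊕-≐ (λ { (inst _ φ) → KwhPI-from-TBtoK (ax (inj₂ (inst φ))) })
                            (λ { (inst φ) → TBtoK-from-KwhPI (fresh-∉FV φ) (ax (inj₂ (inst _ φ))) })
    where
    open tBMS-FS-Extension TBtoK using (KwhPI-from-TBtoK)
    open tBMS-FS-Extension KwhPI using (TBtoK-from-KwhPI)

  KMS-FS-KwhPI≐NeqTBtoK : (S42≈-KMS-FS ⊕ KwhPI) ≐ (S42≈-KMS-FS ⊕ NeqTBtoK)
  KMS-FS-KwhPI≐NeqTBtoK = ⊕-≐ (λ { (inst x φ) → KwhPI-from-NeqTBtoK (ax (inj₂ (inst _ x φ))) })
                              (λ { (inst _ _ _) → NeqTBtoK-from-KwhPI (ax (inj₂ (inst _ _))) })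
    where
    open KMS-FS-Extension NeqTBtoK using (KwhPI-from-NeqTBtoK)
    open KMS-FS-Extension KwhPI using (NeqTBtoK-from-KwhPI)

proposition2 : (Pred : Set) (ar : Pred → ℕ) →
    let open Syntax Pred ar in
      ((S42-tBMS ⊕ KwhPI) ≐ (S42-tBMS ⊕ TBtoK))
      × ((S42-tBMS-FS ⊕ KwhPI) ≐ (S42-tBMS-FS ⊕ TBtoK))
      × ((S42≈-KMS-FS ⊕ KwhPI) ≐ (S42≈-KMS-FS ⊕ NeqTBtoK))
proposition2 Pred ar =
  tBMS-KwhPI≐TBtoK Pred ar , tBMS-FS-KwhPI≐TBtoK Pred ar , KMS-FS-KwhPI≐NeqTBtoK Pred ar
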